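{- Let $A=\{a_1\bmod d_1,\ldots,a_t\bmod d_t\}$ be a coprime disjoint congruence set, with $d_1,\ldots,d_t$ pairwise distinct integers greater than $1$. Then $$\delta(A)=\sum_{s=1}^{t}(-1)^{s+1}\sum_{\substack{1\le i_1<\cdots<i_s\le t\\ \gcd(d_{i_j},d_{i_k})=1 \text{ for all } 1\le j<k\le s}}\frac{1}{d_{i_1}d_{i_2}\cdots d_{i_s}},$$ i.e. the $s$-th inner sum runs over all sets of $s$ of the moduli that are pairwise coprime (empty sums being $0$).
   Context: Two congruences $a\bmod d$ and $a'\bmod d'$ overlap if some integer satisfies both. A set of congruences $\{a_1\bmod d_1,\ldots,a_t\bmod d_t\}$ is coprime disjoint if whenever $a_i\bmod d_i$ and $a_j\bmod d_j$ overlap for $i\neq j$, we have $\gcd(d_i,d_j)=1$. For a congruence set $A$, let $A(N)$ be the number of positive integers $x\le N$ satisfying $x\equiv a_i\pmod{d_i}$ for some $i$; the density of $A$ is $\delta(A)=\lim_{N\to\infty}A(N)/N$. -}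

module Defs where

open import Data.Nat as ℕ using (ℕ; zero; suc)
import Data.Nat.Divisibility as ℕD
open import Data.Nat.Coprimality using (Coprime; coprime?)
open import Data.Integer as ℤ using (ℤ; +_)
open import Data.Integer.Divisibility as ℤD using ()
open import Data.Rational as ℚ using (ℚ; 0ℚ; 1ℚ)
open import Data.Fin using (Fin)
import Data.Fin.Properties as FinP
open import Data.Fin.Subset using (Subset; ∣_∣; inside; outside)
open import Data.Vec using ([]; _∷_)
open import Data.List using (List; []; _∷_; _++_; map; filter; length; applyUpTo; foldr)
open import Data.List.Relation.Unary.AllPairs using (AllPairs; allPairs?)
open import Data.Product using (∃; _×_)
open import Data.Bool using (true; false)
open import Relation.Nullary using (Dec; ¬_)
open import Relation.Nullary.Decidable using (_×-dec_)
open import Relation.Binary.PropositionalEquality using (_≡_; _≢_)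

_≡_[mod_] : ℤ → ℤ → ℕ → Set
x ≡ a [mod d ] = (+ d) ℤD.∣ (x ℤ.- a)

_≡?_[mod_] : (x a : ℤ) (d : ℕ) → Dec (x ≡ a [mod d ])
x ≡? a [mod d ] = ℤ.∣ + d ∣ ℕD.∣? ℤ.∣ x ℤ.- a ∣

Overlap : ℤ → ℕ → ℤ → ℕ → Set
Overlap a d a′ d′ = ∃ λ (x : ℤ) → (x ≡ a [mod d ]) × (x ≡ a′ [mod d′ ])

CoprimeDisjoint : {t : ℕ} → (Fin t → ℤ) → (Fin t → ℕ) → Set
CoprimeDisjoint a d = ∀ i j → i ≢ j → Overlap (a i) (d i) (a j) (d j) → Coprime (d i) (d j)

InSet : {t : ℕ} → (Fin t → ℤ) → (Fin t → ℕ) → ℤ → Set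
InSet a d x = ∃ λ i → x ≡ a i [mod d i ]

inSet? : {t : ℕ} (a : Fin t → ℤ) (d : Fin t → ℕ) (x : ℤ) → Dec (InSet a d x)
inSet? a d x = FinP.any? (λ i → x ≡? a i [mod d i ])

countA : {t : ℕ} → (Fin t → ℤ) → (Fin t → ℕ) → ℕ → ℕ
countA a d N = length (filter (λ x → inSet? a d (+ x)) (applyUpTo suc N))

DensityIs : {t : ℕ} → (Fin t → ℤ) → (Fin t → ℕ) → ℚ → Set
DensityIs a d S = ∀ (ε : ℚ) → 0ℚ ℚ.< ε → ∃ λ N₀ → ∀ N → N₀ ℕ.≤ N →
  ℚ.∣ ((+ countA a d (suc N)) ℚ./ suc N) ℚ.- S ∣ ℚ.< ε

sumℚ : List ℚ → ℚ
sumℚ = foldr ℚ._+_ 0ℚ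

signℚ : ℕ → ℚ
signℚ zero = 1ℚ
signℚ (suc n) = ℚ.- signℚ n

-- 1/n (only used for n ≥ 1; recip 0 = 0 is an arbitrary convention)
recip : ℕ → ℚ
recip zero = 0ℚ
recip (suc n) = (+ 1) ℚ./ suc n

subsets : (t : ℕ) → List (Subset t)
subsets zero = [] ∷ []
subsets (suc t) = map (outside ∷_) (subsets t) ++ map (inside ∷_) (subsets t)

members : {t : ℕ} → Subset t → List (Fin t)
members [] = []
members (true ∷ p) = Fin.zero ∷ map Fin.suc (members p)
  where import Data.Fin as Fin
members (false ∷ p) = map Fin.suc (members p)
  where import Data.Fin as Fin

PairwiseCoprime : {t : ℕ} → (Fin t → ℕ) → Subset t → Set
PairwiseCoprime d S = AllPairs (λ i j → Coprime (d i) (d j)) (members S)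

innerSum : {t : ℕ} → (Fin t → ℕ) → ℕ → ℚ
innerSum {t} d s = sumℚ (map (λ S → recip (foldr ℕ._*_ 1 (map d (members S))))
  (filter (λ S → (∣ S ∣ ℕ.≟ s) ×-dec allPairs? (λ i j → coprime? (d i) (d j)) (members S))
          (subsets t)))

rhs : {t : ℕ} → (Fin t → ℕ) → ℚ
rhs {t} d = sumℚ (map (λ s → signℚ (suc s) ℚ.* innerSum d s) (applyUpTo suc t))

-- Inclusion–exclusion over the sets S of indices turns the indicator of A into
-- 1 − Σ_S (−1)^|S| [x satisfies every congruence of S].  If some x satisfies all
-- congruences of S, coprime disjointness forces the moduli of S to be pairwise
-- coprime, and then by the Chinese remainder theorem these x form a single residue
-- class modulo D_S = ∏_{i∈S} d_i.  Counting over one period M = d_1⋯d_t therefore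
-- gives A(M) = M·δ, where δ is the claimed right-hand side.  Membership in A is
-- M-periodic, so |A(N)·M − A(M)·N| ≤ M², whence A(N)/N → A(M)/M = δ.
module Submission where

open import Defs
open import Data.Bool using (Bool; true; false; _∧_; _∨_; if_then_else_)
open import Data.Fin using (Fin) renaming (zero to fzero; suc to fsuc)
open import Data.Fin.Properties using (any?; suc-injective)
open import Data.Fin.Subset using (Subset; ∣_∣; inside; outside; ⊥)
open import Data.Fin.Subset.Properties using (∣p∣≤n)
open import Data.Integer as ℤ using (ℤ; +_; +0; +[1+_]; -[1+_]; _⊖_)
import Data.Integer.DivMod as ℤDivMod
import Data.Integer.Divisibility.Signed as ℤS
import Data.Integer.Properties as ℤP
open import Data.Integer.Tactic.RingSolver using (solve-∀)
open import Data.List using (List; []; _∷_; _++_; map; filter; length; applyUpTo; upTo)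
open import Data.List.Properties using (applyUpTo-∷ʳ; map-∘; length-applyUpTo)
open import Data.List.Relation.Unary.All as All using (All; []; _∷_)
import Data.List.Relation.Unary.All.Properties as AllP
open import Data.List.Relation.Unary.AllPairs as AllPairs using (AllPairs; []; _∷_; allPairs?)
import Data.List.Relation.Unary.AllPairs.Properties as AllPairsP
open import Data.Nat as ℕ using (ℕ; zero; suc; _≤_; _<_; z≤n; s≤s)
open import Data.Nat.Coprimality as Coprimality using (Coprime; coprime?; coprime-Bézout; coprime-divisor)
import Data.Nat.DivMod as ℕDivMod
import Data.Nat.Divisibility as ℕD
open import Data.Nat.GCD using (module Bézout)
open import Data.Nat.ListAction using (product)
import Data.Nat.Properties as ℕP
import Data.Nat.Tactic.RingSolver as ℕSolver
open import Data.Product using (∃; ∃₂; _×_; _,_; proj₁; proj₂)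
open import Data.Rational as ℚ using (ℚ; 0ℚ; 1ℚ)
import Data.Rational.Properties as ℚP
open import Data.Rational.Solver using (module +-*-Solver)
import Data.Rational.Unnormalised as ℚᵘ
import Data.Rational.Unnormalised.Properties as ℚᵘP
open import Data.Sum using (inj₁; inj₂)
open import Data.Vec using ([]; _∷_)
open import Function using (_∘_; _⇔_; mk⇔; Equivalence)
open import Function.Definitions using (Injective)
open import Relation.Binary.PropositionalEquality
open import Relation.Nullary using (Dec; yes; no; does; contradiction)
open import Relation.Nullary.Decidable using (dec-true; dec-false; does-⇔)

∑ : {A : Set} → List A → (A → ℚ) → ℚ
∑ L f = sumℚ (map f L)

module _ {A : Set} where

  ∑-cong : (L : List A) {f g : A → ℚ} → (∀ x → f x ≡ g x) → ∑ L f ≡ ∑ L g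
  ∑-cong []      f≗g = refl
  ∑-cong (x ∷ L) f≗g = cong₂ ℚ._+_ (f≗g x) (∑-cong L f≗g)

  ∑-++ : (L K : List A) (f : A → ℚ) → ∑ (L ++ K) f ≡ ∑ L f ℚ.+ ∑ K f
  ∑-++ []      K f = sym (ℚP.+-identityˡ _)
  ∑-++ (x ∷ L) K f = trans (cong (f x ℚ.+_) (∑-++ L K f)) (sym (ℚP.+-assoc (f x) _ _))

  ∑-zero : (L : List A) → ∑ L (λ _ → 0ℚ) ≡ 0ℚ
  ∑-zero []      = refl
  ∑-zero (x ∷ L) = trans (ℚP.+-identityˡ _) (∑-zero L)

  ∑-distrib-+ : (L : List A) (f g : A → ℚ) → ∑ L (λ x → f x ℚ.+ g x) ≡ ∑ L f ℚ.+ ∑ L g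
  ∑-distrib-+ []      f g = refl
  ∑-distrib-+ (x ∷ L) f g =
    trans (cong (f x ℚ.+ g x ℚ.+_) (∑-distrib-+ L f g)) (interchange (f x) (g x) (∑ L f) (∑ L g))
    where
    open +-*-Solver
    interchange : ∀ a b c e → (a ℚ.+ b) ℚ.+ (c ℚ.+ e) ≡ (a ℚ.+ c) ℚ.+ (b ℚ.+ e)
    interchange = solve 4 (λ a b c e → (a :+ b) :+ (c :+ e) := (a :+ c) :+ (b :+ e)) refl

  ∑-*ˡ : (L : List A) (c : ℚ) (f : A → ℚ) → ∑ L (λ x → c ℚ.* f x) ≡ c ℚ.* ∑ L f
  ∑-*ˡ []      c f = sym (ℚP.*-zeroʳ c)
  ∑-*ˡ (x ∷ L) c f = trans (cong (c ℚ.* f x ℚ.+_) (∑-*ˡ L c f)) (sym (ℚP.*-distribˡ-+ c (f x) _))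

∑-map : {A B : Set} (L : List A) (h : A → B) (f : B → ℚ) → ∑ (map h L) f ≡ ∑ L (f ∘ h)
∑-map []      h f = refl
∑-map (x ∷ L) h f = cong (f (h x) ℚ.+_) (∑-map L h f)

∑-swap : {A B : Set} (L : List A) (K : List B) (f : A → B → ℚ) →
  ∑ L (λ x → ∑ K (f x)) ≡ ∑ K (λ y → ∑ L (λ x → f x y))
∑-swap []      K f = sym (∑-zero K)
∑-swap (x ∷ L) K f = trans (cong (∑ K (f x) ℚ.+_) (∑-swap L K f))
                           (sym (∑-distrib-+ K (f x) (λ y → ∑ L (λ x′ → f x′ y))))

𝟙 : Bool → ℚ
𝟙 true  = 1ℚ
𝟙 false = 0ℚ

𝟙-∧ : ∀ b c → 𝟙 (b ∧ c) ≡ 𝟙 b ℚ.* 𝟙 c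
𝟙-∧ true  true  = refl
𝟙-∧ true  false = refl
𝟙-∧ false c     = sym (ℚP.*-zeroˡ (𝟙 c))

∑-filter : {A : Set} (L : List A) {P : A → Set} (P? : ∀ x → Dec (P x)) (f : A → ℚ) →
  ∑ (filter P? L) f ≡ ∑ L (λ x → 𝟙 (does (P? x)) ℚ.* f x)
∑-filter []      P? f = refl
∑-filter (x ∷ L) P? f with does (P? x)
... | true  = cong₂ ℚ._+_ (sym (ℚP.*-identityˡ (f x))) (∑-filter L P? f)
... | false = trans (∑-filter L P? f) (sym (trans (cong (ℚ._+ _) (ℚP.*-zeroˡ (f x))) (ℚP.+-identityˡ _)))

ι : ℕ → ℚ
ι n = + n ℚ./ 1

fromℚᵘ-≃ : ∀ p q → p ℚᵘ.≃ q → ℚ.fromℚᵘ p ≡ ℚ.fromℚᵘ q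
fromℚᵘ-≃ p q = ℚP.fromℚᵘ-cong {p} {q}

fromℚᵘ-homo-+ : ∀ p q → ℚ.fromℚᵘ (p ℚᵘ.+ q) ≡ ℚ.fromℚᵘ p ℚ.+ ℚ.fromℚᵘ q
fromℚᵘ-homo-+ p q = ℚP.toℚᵘ-injective (ℚᵘP.≃-trans (ℚP.toℚᵘ-fromℚᵘ _) (ℚᵘP.≃-sym
  (ℚᵘP.≃-trans (ℚP.toℚᵘ-homo-+ (ℚ.fromℚᵘ p) (ℚ.fromℚᵘ q))
               (ℚᵘP.+-cong (ℚP.toℚᵘ-fromℚᵘ p) (ℚP.toℚᵘ-fromℚᵘ q)))))

fromℚᵘ-homo-* : ∀ p q → ℚ.fromℚᵘ (p ℚᵘ.* q) ≡ ℚ.fromℚᵘ p ℚ.* ℚ.fromℚᵘ q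
fromℚᵘ-homo-* p q = ℚP.toℚᵘ-injective (ℚᵘP.≃-trans (ℚP.toℚᵘ-fromℚᵘ _) (ℚᵘP.≃-sym
  (ℚᵘP.≃-trans (ℚP.toℚᵘ-homo-* (ℚ.fromℚᵘ p) (ℚ.fromℚᵘ q))
               (ℚᵘP.*-cong (ℚP.toℚᵘ-fromℚᵘ p) (ℚP.toℚᵘ-fromℚᵘ q)))))

ι-homo-+ : ∀ m n → ι (m ℕ.+ n) ≡ ι m ℚ.+ ι n
ι-homo-+ m n = trans (fromℚᵘ-≃ (ℚᵘ.mkℚᵘ (+ (m ℕ.+ n)) 0) (m′ ℚᵘ.+ n′) (ℚᵘ.*≡* cross)) (fromℚᵘ-homo-+ m′ n′)
  where
  m′ = ℚᵘ.mkℚᵘ (+ m) 0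
  n′ = ℚᵘ.mkℚᵘ (+ n) 0
  normalise : ∀ x y → (x ℤ.+ y) ℤ.* (+ 1 ℤ.* + 1) ≡ (x ℤ.* + 1 ℤ.+ y ℤ.* + 1) ℤ.* + 1
  normalise = solve-∀
  cross : + (m ℕ.+ n) ℤ.* (+ 1 ℤ.* + 1) ≡ (+ m ℤ.* + 1 ℤ.+ + n ℤ.* + 1) ℤ.* + 1
  cross = trans (cong (ℤ._* + 1) (ℤP.pos-+ m n)) (normalise (+ m) (+ n))

ι-homo-* : ∀ m n → ι (m ℕ.* n) ≡ ι m ℚ.* ι n
ι-homo-* m n = trans (fromℚᵘ-≃ (ℚᵘ.mkℚᵘ (+ (m ℕ.* n)) 0) (m′ ℚᵘ.* n′) (ℚᵘ.*≡* (cong (ℤ._* + 1) (ℤP.pos-* m n))))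
                     (fromℚᵘ-homo-* m′ n′)
  where
  m′ = ℚᵘ.mkℚᵘ (+ m) 0
  n′ = ℚᵘ.mkℚᵘ (+ n) 0

ι*recip : ∀ m n → ι m ℚ.* recip (suc n) ≡ + m ℚ./ suc n
ι*recip m n = trans (sym (fromℚᵘ-homo-* m′ n⁻¹))
                    (fromℚᵘ-≃ (m′ ℚᵘ.* n⁻¹) (ℚᵘ.mkℚᵘ (+ m) n) (ℚᵘ.*≡* (normalise (+ m) (+ suc n))))
  where
  m′ = ℚᵘ.mkℚᵘ (+ m) 0
  n⁻¹ = ℚᵘ.mkℚᵘ (+ 1) n
  normalise : ∀ x y → (x ℤ.* + 1) ℤ.* y ≡ x ℤ.* (+ 1 ℤ.* y)
  normalise = solve-∀

ι*recip-cancel : ∀ n → ι (suc n) ℚ.* recip (suc n) ≡ 1ℚ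
ι*recip-cancel n = trans (ι*recip (suc n) n)
  (fromℚᵘ-≃ (ℚᵘ.mkℚᵘ (+ suc n) n) (ℚᵘ.mkℚᵘ (+ 1) 0) (ℚᵘ.*≡* (ℤP.*-comm (+ suc n) (+ 1))))

ι[x]≡ι[m]*q⇒q≡x/m : ∀ {q} x m .{{_ : ℕ.NonZero m}} → ι x ≡ ι m ℚ.* q → q ≡ + x ℚ./ m
ι[x]≡ι[m]*q⇒q≡x/m {q} x m@(suc m′) x≡mq = begin
  q                          ≡⟨ ℚP.*-identityʳ q ⟨
  q ℚ.* 1ℚ                   ≡⟨ cong (q ℚ.*_) (ι*recip-cancel m′) ⟨
  q ℚ.* (ι m ℚ.* recip m)    ≡⟨ solve 3 (λ q m r → q :* (m :* r) := (m :* q) :* r) refl q (ι m) (recip m) ⟩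
  (ι m ℚ.* q) ℚ.* recip m    ≡⟨ cong (ℚ._* recip m) x≡mq ⟨
  ι x ℚ.* recip m            ≡⟨ ι*recip x m′ ⟩
  + x ℚ./ m                  ∎
  where
  open ≡-Reasoning
  open +-*-Solver

∑-const : {A : Set} (L : List A) → ∑ L (λ _ → 1ℚ) ≡ ι (length L)
∑-const []      = refl
∑-const (x ∷ L) = trans (cong (1ℚ ℚ.+_) (∑-const L)) (sym (ι-homo-+ 1 (length L)))

length-filter-as-∑ : {A : Set} (L : List A) {P : A → Set} (P? : ∀ x → Dec (P x)) →
  ι (length (filter P? L)) ≡ ∑ L (λ x → 𝟙 (does (P? x)))
length-filter-as-∑ L P? = begin
  ι (length (filter P? L))                ≡⟨ ∑-const (filter P? L) ⟨
  ∑ (filter P? L) (λ _ → 1ℚ)              ≡⟨ ∑-filter L P? (λ _ → 1ℚ) ⟩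
  ∑ L (λ x → 𝟙 (does (P? x)) ℚ.* 1ℚ)      ≡⟨ ∑-cong L (λ x → ℚP.*-identityʳ _) ⟩
  ∑ L (λ x → 𝟙 (does (P? x)))             ∎
  where open ≡-Reasoning

inclusion-exclusion : ∀ t {P : Fin t → Set} (P? : ∀ i → Dec (P i)) →
  𝟙 (does (any? P?)) ℚ.+ ∑ (subsets t) (λ S → signℚ ∣ S ∣ ℚ.* 𝟙 (does (All.all? P? (members S)))) ≡ 1ℚ
inclusion-exclusion zero    P? = refl
inclusion-exclusion (suc t) P? = begin
  𝟙 (b₀ ∨ b) ℚ.+ ∑ (map (outside ∷_) L ++ map (inside ∷_) L) F
    ≡⟨ cong (𝟙 (b₀ ∨ b) ℚ.+_) (trans (∑-++ (map (outside ∷_) L) _ F) (cong₂ ℚ._+_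
         (trans (∑-map L _ F) (∑-cong L F-outside))
         (trans (∑-map L _ F) (trans (∑-cong L F-inside) (∑-*ˡ L (ℚ.- 𝟙 b₀) G))))) ⟩
  𝟙 (b₀ ∨ b) ℚ.+ (∑ L G ℚ.+ ℚ.- 𝟙 b₀ ℚ.* ∑ L G)
    ≡⟨ combine b₀ ⟩
  1ℚ ∎
  where
  open ≡-Reasoning
  open +-*-Solver
  L = subsets t
  b₀ = does (P? fzero)
  b = does (any? (P? ∘ fsuc))
  allᶠ : Subset t → Bool
  allᶠ S = does (All.all? (P? ∘ fsuc) (members S))
  F : Subset (suc t) → ℚ
  F S = signℚ ∣ S ∣ ℚ.* 𝟙 (does (All.all? P? (members S)))
  G : Subset t → ℚ
  G S = signℚ ∣ S ∣ ℚ.* 𝟙 (allᶠ S)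
  all-fsuc : ∀ S → does (All.all? P? (map fsuc (members S))) ≡ allᶠ S
  all-fsuc S = does-⇔ (mk⇔ AllP.map⁻ AllP.map⁺) (All.all? P? (map fsuc (members S))) (All.all? (P? ∘ fsuc) (members S))
  F-outside : ∀ S → F (outside ∷ S) ≡ G S
  F-outside S = cong (λ c → signℚ ∣ S ∣ ℚ.* 𝟙 c) (all-fsuc S)
  F-inside : ∀ S → F (inside ∷ S) ≡ ℚ.- 𝟙 b₀ ℚ.* G S
  F-inside S = begin
    ℚ.- signℚ ∣ S ∣ ℚ.* 𝟙 (b₀ ∧ does (All.all? P? (map fsuc (members S))))
      ≡⟨ cong (λ c → ℚ.- signℚ ∣ S ∣ ℚ.* 𝟙 (b₀ ∧ c)) (all-fsuc S) ⟩
    ℚ.- signℚ ∣ S ∣ ℚ.* 𝟙 (b₀ ∧ allᶠ S)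
      ≡⟨ cong (ℚ.- signℚ ∣ S ∣ ℚ.*_) (𝟙-∧ b₀ (allᶠ S)) ⟩
    ℚ.- signℚ ∣ S ∣ ℚ.* (𝟙 b₀ ℚ.* 𝟙 (allᶠ S))
      ≡⟨ solve 3 (λ s o y → (:- s) :* (o :* y) := (:- o) :* (s :* y)) refl (signℚ ∣ S ∣) (𝟙 b₀) (𝟙 (allᶠ S)) ⟩
    ℚ.- 𝟙 b₀ ℚ.* G S ∎
  combine : ∀ b₀ → 𝟙 (b₀ ∨ b) ℚ.+ (∑ L G ℚ.+ ℚ.- 𝟙 b₀ ℚ.* ∑ L G) ≡ 1ℚ
  combine true  = solve 1 (λ X → con 1ℚ :+ (X :+ (:- con 1ℚ) :* X) := con 1ℚ) refl (∑ L G)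
  combine false = trans (solve 2 (λ c X → c :+ (X :+ (:- con 0ℚ) :* X) := c :+ X) refl (𝟙 b) (∑ L G))
                        (inclusion-exclusion t (P? ∘ fsuc))

δ : ℕ → ℕ → ℚ
δ n s = 𝟙 (does (n ℕ.≟ s))

δ-refl : ∀ n → δ n n ≡ 1ℚ
δ-refl n = cong 𝟙 (dec-true (n ℕ.≟ n) refl)

δ-≢ : ∀ {n s} → n ≢ s → δ n s ≡ 0ℚ
δ-≢ {n} {s} n≢s = cong 𝟙 (dec-false (n ℕ.≟ s) n≢s)

∑-upTo-snoc : (f : ℕ → ℚ) (m : ℕ) → ∑ (upTo (suc m)) f ≡ ∑ (upTo m) f ℚ.+ f m
∑-upTo-snoc f m = begin
  ∑ (upTo (suc m)) f            ≡⟨ cong (λ L → ∑ L f) (applyUpTo-∷ʳ (λ i → i) m) ⟨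
  ∑ (upTo m ++ m ∷ []) f        ≡⟨ ∑-++ (upTo m) (m ∷ []) f ⟩
  ∑ (upTo m) f ℚ.+ (f m ℚ.+ 0ℚ) ≡⟨ cong (∑ (upTo m) f ℚ.+_) (ℚP.+-identityʳ (f m)) ⟩
  ∑ (upTo m) f ℚ.+ f m          ∎
  where open ≡-Reasoning

∑-upTo-δ-absent : (h : ℕ → ℚ) {n : ℕ} (m : ℕ) → m ≤ n → ∑ (upTo m) (λ s → δ n s ℚ.* h s) ≡ 0ℚ
∑-upTo-δ-absent h     zero    m≤n = refl
∑-upTo-δ-absent h {n} (suc m) m<n = begin
  ∑ (upTo (suc m)) (λ s → δ n s ℚ.* h s)              ≡⟨ ∑-upTo-snoc _ m ⟩
  ∑ (upTo m) (λ s → δ n s ℚ.* h s) ℚ.+ δ n m ℚ.* h m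
    ≡⟨ cong₂ ℚ._+_ (∑-upTo-δ-absent h m (ℕP.<⇒≤ m<n)) (cong (ℚ._* h m) (δ-≢ (ℕP.>⇒≢ m<n))) ⟩
  0ℚ ℚ.+ 0ℚ ℚ.* h m                                   ≡⟨ cong (0ℚ ℚ.+_) (ℚP.*-zeroˡ (h m)) ⟩
  0ℚ                                                  ∎
  where open ≡-Reasoning

∑-upTo-δ : (h : ℕ → ℚ) {n : ℕ} (m : ℕ) → n < m → ∑ (upTo m) (λ s → δ n s ℚ.* h s) ≡ h n
∑-upTo-δ h {n} (suc m) n<1+m with ℕP.m≤n⇒m<n∨m≡n (ℕP.≤-pred n<1+m)
... | inj₁ n<m = begin
  ∑ (upTo (suc m)) (λ s → δ n s ℚ.* h s)              ≡⟨ ∑-upTo-snoc _ m ⟩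
  ∑ (upTo m) (λ s → δ n s ℚ.* h s) ℚ.+ δ n m ℚ.* h m
    ≡⟨ cong₂ ℚ._+_ (∑-upTo-δ h m n<m) (cong (ℚ._* h m) (δ-≢ (ℕP.<⇒≢ n<m))) ⟩
  h n ℚ.+ 0ℚ ℚ.* h m                                  ≡⟨ cong (h n ℚ.+_) (ℚP.*-zeroˡ (h m)) ⟩
  h n ℚ.+ 0ℚ                                          ≡⟨ ℚP.+-identityʳ (h n) ⟩
  h n                                                 ∎
  where open ≡-Reasoning
... | inj₂ refl = begin
  ∑ (upTo (suc n)) (λ s → δ n s ℚ.* h s)              ≡⟨ ∑-upTo-snoc _ n ⟩
  ∑ (upTo n) (λ s → δ n s ℚ.* h s) ℚ.+ δ n n ℚ.* h n
    ≡⟨ cong₂ ℚ._+_ (∑-upTo-δ-absent h n ℕP.≤-refl) (cong (ℚ._* h n) (δ-refl n)) ⟩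
  0ℚ ℚ.+ 1ℚ ℚ.* h n                                   ≡⟨ ℚP.+-identityˡ _ ⟩
  1ℚ ℚ.* h n                                          ≡⟨ ℚP.*-identityˡ (h n) ⟩
  h n                                                 ∎
  where open ≡-Reasoning

-- The sum over s ∈ {1, …, t} is the sum over {0, …, t} minus its s = 0 term.
∑-alternating-δ : ∀ t {k} → k ≤ t → (w : ℚ) →
  ∑ (applyUpTo suc t) (λ s → signℚ (suc s) ℚ.* (δ k s ℚ.* w)) ≡ ℚ.- 1ℚ ℚ.* (signℚ k ℚ.* w) ℚ.+ δ k 0 ℚ.* w
∑-alternating-δ t {k} k≤t w = begin
  A                                     ≡⟨ solve 2 (λ f a → a := (f :+ a) :- f) refl (F 0) A ⟩
  (F 0 ℚ.+ A) ℚ.- F 0                   ≡⟨ cong (ℚ._- F 0) whole-range ⟩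
  signℚ (suc k) ℚ.* w ℚ.- F 0
    ≡⟨ solve 3 (λ s e w → (:- s) :* w :- (:- con 1ℚ) :* (e :* w) := (:- con 1ℚ) :* (s :* w) :+ e :* w)
               refl (signℚ k) (δ k 0) w ⟩
  ℚ.- 1ℚ ℚ.* (signℚ k ℚ.* w) ℚ.+ δ k 0 ℚ.* w ∎
  where
  open ≡-Reasoning
  open +-*-Solver
  F : ℕ → ℚ
  F s = signℚ (suc s) ℚ.* (δ k s ℚ.* w)
  A = ∑ (applyUpTo suc t) F
  whole-range : F 0 ℚ.+ A ≡ signℚ (suc k) ℚ.* w
  whole-range = trans
    (∑-cong (upTo (suc t)) (λ s → solve 3 (λ a e w → a :* (e :* w) := e :* (a :* w)) refl (signℚ (suc s)) (δ k s) w))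
    (∑-upTo-δ (λ s → signℚ (suc s) ℚ.* w) (suc t) (s≤s k≤t))

∑-subsets-δ₀ : ∀ t (f : Subset t → ℚ) → ∑ (subsets t) (λ S → δ ∣ S ∣ 0 ℚ.* f S) ≡ f ⊥
∑-subsets-δ₀ zero    f = trans (ℚP.+-identityʳ _) (ℚP.*-identityˡ _)
∑-subsets-δ₀ (suc t) f = begin
  ∑ (map (outside ∷_) L ++ map (inside ∷_) L) F
    ≡⟨ ∑-++ (map (outside ∷_) L) _ F ⟩
  ∑ (map (outside ∷_) L) F ℚ.+ ∑ (map (inside ∷_) L) F
    ≡⟨ cong₂ ℚ._+_ (trans (∑-map L _ F) (∑-subsets-δ₀ t (f ∘ (outside ∷_))))
                   (trans (∑-map L _ F) (trans (∑-cong L (λ S → ℚP.*-zeroˡ (f (inside ∷ S)))) (∑-zero L))) ⟩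
  f ⊥ ℚ.+ 0ℚ
    ≡⟨ ℚP.+-identityʳ _ ⟩
  f ⊥ ∎
  where
  open ≡-Reasoning
  L = subsets t
  F : Subset (suc t) → ℚ
  F S = δ ∣ S ∣ 0 ℚ.* f S

members-⊥ : ∀ t → members (⊥ {t}) ≡ []
members-⊥ zero    = refl
members-⊥ (suc t) = cong (map fsuc) (members-⊥ t)

∏ : {t : ℕ} → (Fin t → ℕ) → Subset t → ℕ
∏ d S = product (map d (members S))

isPairwiseCoprime : {t : ℕ} → (Fin t → ℕ) → Subset t → Bool
isPairwiseCoprime d S = does (allPairs? (λ i j → coprime? (d i) (d j)) (members S))

weight : {t : ℕ} → (Fin t → ℕ) → Subset t → ℚ
weight d S = 𝟙 (isPairwiseCoprime d S) ℚ.* recip (∏ d S)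

weight-⊥ : ∀ {t} (d : Fin t → ℕ) → weight d ⊥ ≡ 1ℚ
weight-⊥ {t} d rewrite members-⊥ t = refl

innerSum-as-∑ : ∀ {t} (d : Fin t → ℕ) s → innerSum d s ≡ ∑ (subsets t) (λ S → δ ∣ S ∣ s ℚ.* weight d S)
innerSum-as-∑ {t} d s = trans (∑-filter (subsets t) _ (recip ∘ ∏ d)) (∑-cong (subsets t) λ S →
  trans (cong (ℚ._* recip (∏ d S)) (𝟙-∧ (does (∣ S ∣ ℕ.≟ s)) (isPairwiseCoprime d S)))
        (ℚP.*-assoc (δ ∣ S ∣ s) (𝟙 (isPairwiseCoprime d S)) (recip (∏ d S))))

rhs-as-signed-∑ : ∀ {t} (d : Fin t → ℕ) → rhs d ≡ 1ℚ ℚ.- ∑ (subsets t) (λ S → signℚ ∣ S ∣ ℚ.* weight d S)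
rhs-as-signed-∑ {t} d = begin
  ∑ U (λ s → signℚ (suc s) ℚ.* innerSum d s)
    ≡⟨ ∑-cong U (λ s → trans (cong (signℚ (suc s) ℚ.*_) (innerSum-as-∑ d s)) (sym (∑-*ˡ SS (signℚ (suc s)) _))) ⟩
  ∑ U (λ s → ∑ SS (λ S → signℚ (suc s) ℚ.* (δ ∣ S ∣ s ℚ.* weight d S)))
    ≡⟨ ∑-swap U SS _ ⟩
  ∑ SS (λ S → ∑ U (λ s → signℚ (suc s) ℚ.* (δ ∣ S ∣ s ℚ.* weight d S)))
    ≡⟨ ∑-cong SS (λ S → ∑-alternating-δ t (∣p∣≤n S) (weight d S)) ⟩
  ∑ SS (λ S → ℚ.- 1ℚ ℚ.* (signℚ ∣ S ∣ ℚ.* weight d S) ℚ.+ δ ∣ S ∣ 0 ℚ.* weight d S)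
    ≡⟨ ∑-distrib-+ SS _ _ ⟩
  ∑ SS (λ S → ℚ.- 1ℚ ℚ.* (signℚ ∣ S ∣ ℚ.* weight d S)) ℚ.+ ∑ SS (λ S → δ ∣ S ∣ 0 ℚ.* weight d S)
    ≡⟨ cong₂ ℚ._+_ (∑-*ˡ SS (ℚ.- 1ℚ) _) (trans (∑-subsets-δ₀ t (weight d)) (weight-⊥ d)) ⟩
  ℚ.- 1ℚ ℚ.* T ℚ.+ 1ℚ
    ≡⟨ solve 1 (λ T → (:- con 1ℚ) :* T :+ con 1ℚ := con 1ℚ :- T) refl T ⟩
  1ℚ ℚ.- T ∎
  where
  open ≡-Reasoning
  open +-*-Solver
  U = applyUpTo suc t
  SS = subsets t
  T = ∑ SS (λ S → signℚ ∣ S ∣ ℚ.* weight d S)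

≡[mod]⇒∣ : ∀ {d} x a → x ≡ a [mod d ] → + d ℤS.∣ (x ℤ.- a)
≡[mod]⇒∣ x a = ℤS.∣ᵤ⇒∣

≡[mod]-sym : ∀ {d} x a → x ≡ a [mod d ] → a ≡ x [mod d ]
≡[mod]-sym {d} x a x≡a = ℤS.∣⇒∣ᵤ (subst (+ d ℤS.∣_) (negate x a) (ℤS.∣m⇒∣-m (≡[mod]⇒∣ x a x≡a)))
  where
  negate : ∀ x a → ℤ.- (x ℤ.- a) ≡ a ℤ.- x
  negate = solve-∀

≡[mod]-trans : ∀ {d} x b a → x ≡ b [mod d ] → b ≡ a [mod d ] → x ≡ a [mod d ]
≡[mod]-trans {d} x b a x≡b b≡a = ℤS.∣⇒∣ᵤ (subst (+ d ℤS.∣_) (telescope x b a)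
  (ℤS.∣m∣n⇒∣m+n (≡[mod]⇒∣ x b x≡b) (≡[mod]⇒∣ b a b≡a)))
  where
  telescope : ∀ x b a → (x ℤ.- b) ℤ.+ (b ℤ.- a) ≡ x ℤ.- a
  telescope = solve-∀

≡[mod]-+-period : ∀ {d D} x a → d ℕD.∣ D → ((x ℤ.+ + D) ≡ a [mod d ]) ⇔ (x ≡ a [mod d ])
≡[mod]-+-period {d} {D} x a d∣D = mk⇔
  (λ h → ℤS.∣⇒∣ᵤ {+ d} {x ℤ.- a}
           (ℤS.∣m+n∣n⇒∣m (subst (+ d ℤS.∣_) (shift x a (+ D)) (≡[mod]⇒∣ (x ℤ.+ + D) a h)) d∣+D))
  (λ h → ℤS.∣⇒∣ᵤ (subst (+ d ℤS.∣_) (sym (shift x a (+ D))) (ℤS.∣m∣n⇒∣m+n (≡[mod]⇒∣ x a h) d∣+D)))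
  where
  d∣+D : + d ℤS.∣ + D
  d∣+D = ℤS.∣ᵤ⇒∣ d∣D
  shift : ∀ x a k → x ℤ.+ k ℤ.- a ≡ (x ℤ.- a) ℤ.+ k
  shift = solve-∀

≡[mod]-+-cancelˡ : ∀ {d} k x y → (k ℤ.+ x) ≡ (k ℤ.+ y) [mod d ] → x ≡ y [mod d ]
≡[mod]-+-cancelˡ {d} k x y = subst (λ z → d ℕD.∣ ℤ.∣ z ∣) (cancel k x y)
  where
  cancel : ∀ k x y → (k ℤ.+ x) ℤ.- (k ℤ.+ y) ≡ x ℤ.- y
  cancel = solve-∀

residue-unique : ∀ {D i j} → i < D → j < D → (+ i) ≡ (+ j) [mod D ] → i ≡ j
residue-unique {D} {i} {j} i<D j<D D∣i-j =
  ℤP.+-injective (ℤP.i-j≡0⇒i≡j (+ i) (+ j) (ℤP.∣i∣≡0⇒i≡0 (divisor-below D∣i-j ∣i-j∣<D)))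
  where
  ∣i-j∣<D : ℤ.∣ + i ℤ.- + j ∣ < D
  ∣i-j∣<D = ℕP.≤-<-trans (ℕP.≤-reflexive (cong ℤ.∣_∣ (ℤP.m-n≡m⊖n i j)))
              (ℕP.≤-<-trans (ℤP.∣m⊝n∣≤m⊔n i j) (ℕP.⊔-pres-<m i<D j<D))
  divisor-below : ∀ {k} → D ℕD.∣ k → k < D → k ≡ 0
  divisor-below {zero}  _   _   = refl
  divisor-below {suc k} D∣k k<D = contradiction D∣k (ℕD.>⇒∤ k<D)

-- The representative of the residue class of c in {1, …, D}.
≡[mod]-representative : ∀ D .{{_ : ℕ.NonZero D}} c → (+ suc ((c ℤ.- + 1) ℤDivMod.%ℕ D)) ≡ c [mod D ]
≡[mod]-representative D c = ℤS.∣⇒∣ᵤ (ℤS.divides (ℤ.- q) (begin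
  + suc r ℤ.- c                                   ≡⟨ cong (λ z → + suc r ℤ.- z) c≡ ⟩
  + suc r ℤ.- ((+ r ℤ.+ q ℤ.* + D) ℤ.+ + 1)       ≡⟨ cancel (+ r) q (+ D) ⟩
  ℤ.- q ℤ.* + D                                    ∎))
  where
  open ≡-Reasoning
  r = (c ℤ.- + 1) ℤDivMod.%ℕ D
  q = (c ℤ.- + 1) ℤDivMod./ℕ D
  sub-add : ∀ c → c ≡ (c ℤ.- + 1) ℤ.+ + 1
  sub-add = solve-∀
  c≡ : c ≡ (+ r ℤ.+ q ℤ.* + D) ℤ.+ + 1
  c≡ = trans (sub-add c) (cong (ℤ._+ + 1) (ℤDivMod.a≡a%ℕn+[a/ℕn]*n (c ℤ.- + 1) D))
  cancel : ∀ r q D → (+ 1 ℤ.+ r) ℤ.- ((r ℤ.+ q ℤ.* D) ℤ.+ + 1) ≡ ℤ.- q ℤ.* D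
  cancel = solve-∀

coprime-* : ∀ {m a b} → Coprime m a → Coprime m b → Coprime m (a ℕ.* b)
coprime-* {m} {a} m⊥a m⊥b (k∣m , k∣ab) = m⊥b (k∣m , coprime-divisor k⊥a k∣ab)
  where
  k⊥a : Coprime _ a
  k⊥a (j∣k , j∣a) = m⊥a (ℕD.∣-trans j∣k k∣m , j∣a)

coprime-product : ∀ {m} ns → All (Coprime m) ns → Coprime m (product ns)
coprime-product []       []         = Coprimality.sym (Coprimality.1-coprimeTo _)
coprime-product (n ∷ ns) (m⊥n ∷ hs) = coprime-* m⊥n (coprime-product ns hs)

coprime-∣-* : ∀ {m n k} → Coprime m n → m ℕD.∣ k → n ℕD.∣ k → m ℕ.* n ℕD.∣ k
coprime-∣-* {m} {n} m⊥n m∣k (ℕD.divides q refl)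
  with coprime-divisor m⊥n (subst (m ℕD.∣_) (ℕP.*-comm q n) m∣k)
... | ℕD.divides p refl = ℕD.divides p (ℕP.*-assoc p m n)

pos-lift : ∀ x p y q → 1 ℕ.+ y ℕ.* q ≡ x ℕ.* p → + 1 ℤ.+ + y ℤ.* + q ≡ + x ℤ.* + p
pos-lift x p y q eq = begin
  + 1 ℤ.+ + y ℤ.* + q   ≡⟨ cong (ℤ._+_ (+ 1)) (ℤP.pos-* y q) ⟨
  + 1 ℤ.+ + (y ℕ.* q)   ≡⟨ ℤP.pos-+ 1 (y ℕ.* q) ⟨
  + (1 ℕ.+ y ℕ.* q)     ≡⟨ cong +_ eq ⟩
  + (x ℕ.* p)           ≡⟨ ℤP.pos-* x p ⟩
  + x ℤ.* + p           ∎
  where open ≡-Reasoning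

bézout : ∀ {m n} → Coprime m n → ∃₂ λ u v → u ℤ.* + m ℤ.+ v ℤ.* + n ≡ + 1
bézout {m} {n} m⊥n with coprime-Bézout m⊥n
... | Bézout.+- x y eq = + x , ℤ.- + y ,
  trans (cong (ℤ._+ ℤ.- + y ℤ.* + n) (sym (pos-lift x m y n eq))) (cancel (+ y) (+ n))
  where
  cancel : ∀ y n → (+ 1 ℤ.+ y ℤ.* n) ℤ.+ ℤ.- y ℤ.* n ≡ + 1
  cancel = solve-∀
... | Bézout.-+ x y eq = ℤ.- + x , + y ,
  trans (cong (ℤ._+_ (ℤ.- + x ℤ.* + m)) (sym (pos-lift y n x m eq))) (cancel (+ x) (+ m))
  where
  cancel : ∀ x m → ℤ.- x ℤ.* m ℤ.+ (+ 1 ℤ.+ x ℤ.* m) ≡ + 1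
  cancel = solve-∀

crt₂ : ∀ {m n} → Coprime m n → ∀ a b →
  ∃ λ c → ∀ x → (x ≡ a [mod m ] × x ≡ b [mod n ]) ⇔ x ≡ c [mod m ℕ.* n ]
crt₂ {m} {n} m⊥n a b with bézout m⊥n
... | u , v , bz = c , λ x → mk⇔ (into x) (outof x)
  where
  -- u m ≡ 1 (mod n) and u m ≡ 0 (mod m)
  c = a ℤ.+ (b ℤ.- a) ℤ.* u ℤ.* + m
  c≡a : c ≡ a [mod m ]
  c≡a = ℤS.∣⇒∣ᵤ (ℤS.divides ((b ℤ.- a) ℤ.* u) (cancel a b u (+ m)))
    where
    cancel : ∀ a b u m → (a ℤ.+ (b ℤ.- a) ℤ.* u ℤ.* m) ℤ.- a ≡ ((b ℤ.- a) ℤ.* u) ℤ.* m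
    cancel = solve-∀
  c≡b : c ≡ b [mod n ]
  c≡b = ℤS.∣⇒∣ᵤ (ℤS.divides ((a ℤ.- b) ℤ.* v) (begin
    c ℤ.- b                                                     ≡⟨ expand a b u v (+ m) (+ n) ⟩
    ((a ℤ.- b) ℤ.* v) ℤ.* + n ℤ.+ (a ℤ.- b) ℤ.* (+ 1 ℤ.- (u ℤ.* + m ℤ.+ v ℤ.* + n))
      ≡⟨ cong (λ z → ((a ℤ.- b) ℤ.* v) ℤ.* + n ℤ.+ (a ℤ.- b) ℤ.* (+ 1 ℤ.- z)) bz ⟩
    ((a ℤ.- b) ℤ.* v) ℤ.* + n ℤ.+ (a ℤ.- b) ℤ.* (+ 1 ℤ.- + 1) ≡⟨ vanish _ (a ℤ.- b) ⟩
    ((a ℤ.- b) ℤ.* v) ℤ.* + n                                   ∎))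
    where
    open ≡-Reasoning
    expand : ∀ a b u v m n → (a ℤ.+ (b ℤ.- a) ℤ.* u ℤ.* m) ℤ.- b
      ≡ ((a ℤ.- b) ℤ.* v) ℤ.* n ℤ.+ (a ℤ.- b) ℤ.* (+ 1 ℤ.- (u ℤ.* m ℤ.+ v ℤ.* n))
    expand = solve-∀
    vanish : ∀ z k → z ℤ.+ k ℤ.* (+ 1 ℤ.- + 1) ≡ z
    vanish = solve-∀
  into : ∀ x → x ≡ a [mod m ] × x ≡ b [mod n ] → x ≡ c [mod m ℕ.* n ]
  into x (x≡a , x≡b) = coprime-∣-* m⊥n (≡[mod]-trans x a c x≡a (≡[mod]-sym c a c≡a))
                                        (≡[mod]-trans x b c x≡b (≡[mod]-sym c b c≡b))
  outof : ∀ x → x ≡ c [mod m ℕ.* n ] → x ≡ a [mod m ] × x ≡ b [mod n ]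
  outof x x≡c = ≡[mod]-trans x c a (ℕD.∣-trans (ℕD.m∣m*n n) x≡c) c≡a
              , ≡[mod]-trans x c b (ℕD.∣-trans (ℕD.n∣m*n m) x≡c) c≡b

module _ {t : ℕ} (a : Fin t → ℤ) (d : Fin t → ℕ) where

  SatisfiesAll : ℤ → List (Fin t) → Set
  SatisfiesAll x = All (λ i → x ≡ a i [mod d i ])

  crt : ∀ is → AllPairs (λ i j → Coprime (d i) (d j)) is →
    ∃ λ c → ∀ x → SatisfiesAll x is ⇔ x ≡ c [mod product (map d is) ]
  crt []       []           = + 0 , λ x → mk⇔ (λ _ → ℕD.1∣ _) (λ _ → [])
  crt (i ∷ is) (i⊥is ∷ ⊥is) = c , λ x → mk⇔
    (λ { (h ∷ hs) → Equivalence.to (both⇔c x) (h , Equivalence.to (rest⇔c′ x) hs) })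
    (λ h → let h₁ , h₂ = Equivalence.from (both⇔c x) h in h₁ ∷ Equivalence.from (rest⇔c′ x) h₂)
    where
    c′ = crt is ⊥is .proj₁
    rest⇔c′ = crt is ⊥is .proj₂
    c = crt₂ (coprime-product (map d is) (AllP.map⁺ i⊥is)) (a i) c′ .proj₁
    both⇔c = crt₂ (coprime-product (map d is) (AllP.map⁺ i⊥is)) (a i) c′ .proj₂

  satisfiesAll⇒pairwiseCoprime : CoprimeDisjoint a d → ∀ x {is} → AllPairs _≢_ is → SatisfiesAll x is →
    AllPairs (λ i j → Coprime (d i) (d j)) is
  satisfiesAll⇒pairwiseCoprime disjoint x         []           []        = []
  satisfiesAll⇒pairwiseCoprime disjoint x {i ∷ _} (i≢is ∷ ≢is) (hᵢ ∷ hs) =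
    All.zipWith coprime-with (i≢is , hs) ∷ satisfiesAll⇒pairwiseCoprime disjoint x ≢is hs
    where
    coprime-with : ∀ {j} → i ≢ j × x ≡ a j [mod d j ] → Coprime (d i) (d j)
    coprime-with {j} (i≢j , hⱼ) = disjoint i j i≢j (x , hᵢ , hⱼ)

map-fsuc-distinct : ∀ {t} {is : List (Fin t)} → AllPairs _≢_ is → AllPairs _≢_ (map fsuc is)
map-fsuc-distinct = AllPairsP.map⁺ ∘ AllPairs.map (λ i≢j → i≢j ∘ suc-injective)

members-distinct : ∀ {t} (S : Subset t) → AllPairs _≢_ (members S)
members-distinct []          = []
members-distinct (true ∷ S)  =
  AllP.map⁺ (All.universal (λ _ ()) (members S)) ∷ map-fsuc-distinct (members-distinct S)
members-distinct (false ∷ S) = map-fsuc-distinct (members-distinct S)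

count : (ℕ → Bool) → ℕ → ℕ
count b zero    = 0
count b (suc n) = if b 0 then suc (count (b ∘ suc) n) else count (b ∘ suc) n

length-filter-applyUpTo : ∀ {P : ℕ → Set} (P? : ∀ x → Dec (P x)) (f : ℕ → ℕ) n →
  length (filter P? (applyUpTo f n)) ≡ count (λ i → does (P? (f i))) n
length-filter-applyUpTo P? f zero    = refl
length-filter-applyUpTo P? f (suc n) with does (P? (f 0))
... | true  = cong suc (length-filter-applyUpTo P? (f ∘ suc) n)
... | false = length-filter-applyUpTo P? (f ∘ suc) n

count-cong : ∀ {b b′ : ℕ → Bool} n → (∀ i → i < n → b i ≡ b′ i) → count b n ≡ count b′ n
count-cong                 zero    b≗b′ = refl
count-cong {b} {b′} (suc n) b≗b′
  rewrite b≗b′ 0 (s≤s z≤n) | count-cong {b ∘ suc} {b′ ∘ suc} n (λ i i<n → b≗b′ (suc i) (s≤s i<n)) = refl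

count-≤ : ∀ b n → count b n ≤ n
count-≤ b zero    = z≤n
count-≤ b (suc n) with b 0
... | true  = s≤s (count-≤ (b ∘ suc) n)
... | false = ℕP.m≤n⇒m≤1+n (count-≤ (b ∘ suc) n)

count-+ : ∀ b m n → count b (m ℕ.+ n) ≡ count b m ℕ.+ count (λ i → b (m ℕ.+ i)) n
count-+ b zero    n = refl
count-+ b (suc m) n with b 0
... | true  = cong suc (count-+ (b ∘ suc) m n)
... | false = count-+ (b ∘ suc) m n

count-periodic : ∀ b p → (∀ i → b (p ℕ.+ i) ≡ b i) → ∀ k r →
  count b (k ℕ.* p ℕ.+ r) ≡ k ℕ.* count b p ℕ.+ count b r
count-periodic b p periodic zero    r = refl
count-periodic b p periodic (suc k) r = begin
  count b ((p ℕ.+ k ℕ.* p) ℕ.+ r)                  ≡⟨ cong (count b) (ℕP.+-assoc p (k ℕ.* p) r) ⟩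
  count b (p ℕ.+ (k ℕ.* p ℕ.+ r))                  ≡⟨ count-+ b p _ ⟩
  count b p ℕ.+ count (λ i → b (p ℕ.+ i)) (k ℕ.* p ℕ.+ r)
    ≡⟨ cong (count b p ℕ.+_) (count-cong (k ℕ.* p ℕ.+ r) (λ i _ → periodic i)) ⟩
  count b p ℕ.+ count b (k ℕ.* p ℕ.+ r)            ≡⟨ cong (count b p ℕ.+_) (count-periodic b p periodic k r) ⟩
  count b p ℕ.+ (k ℕ.* count b p ℕ.+ count b r)    ≡⟨ ℕP.+-assoc (count b p) _ _ ⟨
  count b p ℕ.+ k ℕ.* count b p ℕ.+ count b r      ∎
  where open ≡-Reasoning

count-none : ∀ b n → (∀ i → b i ≡ false) → count b n ≡ 0
count-none b zero    b≗false = refl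
count-none b (suc n) b≗false rewrite b≗false 0 = count-none (b ∘ suc) n (b≗false ∘ suc)

count-single : ∀ {r n} → r < n → count (λ i → does (i ℕ.≟ r)) n ≡ 1
count-single {zero}  {suc n} _         = cong suc (count-none _ n (λ _ → refl))
count-single {suc r} {suc n} (s≤s r<n) = count-single r<n

count-deviation : ∀ b p .{{_ : ℕ.NonZero p}} → (∀ i → b (p ℕ.+ i) ≡ b i) → ∀ n →
  ℤ.∣ count b n ℕ.* p ⊖ count b p ℕ.* n ∣ ≤ p ℕ.* p
count-deviation b p periodic n = begin
  ℤ.∣ count b n ℕ.* p ⊖ c ℕ.* n ∣
    ≡⟨ cong₂ (λ u v → ℤ.∣ u ⊖ v ∣) (trans (cong (ℕ._* p) count-n) (expand₁ k c e p))
                                   (trans (cong (c ℕ.*_) n≡) (expand₂ k c r p)) ⟩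
  ℤ.∣ (k ℕ.* c ℕ.* p ℕ.+ e ℕ.* p) ⊖ (k ℕ.* c ℕ.* p ℕ.+ c ℕ.* r) ∣
    ≡⟨ cong ℤ.∣_∣ (ℤP.+-cancelˡ-⊖ (k ℕ.* c ℕ.* p) _ _) ⟩
  ℤ.∣ e ℕ.* p ⊖ c ℕ.* r ∣
    ≤⟨ ℤP.∣m⊝n∣≤m⊔n (e ℕ.* p) (c ℕ.* r) ⟩
  e ℕ.* p ℕ.⊔ c ℕ.* r
    ≤⟨ ℕP.⊔-lub (ℕP.*-monoˡ-≤ p (ℕP.≤-trans (count-≤ b r) r≤p)) (ℕP.*-mono-≤ (count-≤ b p) r≤p) ⟩
  p ℕ.* p ∎
  where
  open ℕP.≤-Reasoning
  k = n ℕ./ p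
  r = n ℕ.% p
  c = count b p
  e = count b r
  r≤p : r ≤ p
  r≤p = ℕP.<⇒≤ (ℕDivMod.m%n<n n p)
  n≡ : n ≡ k ℕ.* p ℕ.+ r
  n≡ = trans (ℕDivMod.m≡m%n+[m/n]*n n p) (ℕP.+-comm r (k ℕ.* p))
  count-n : count b n ≡ k ℕ.* c ℕ.+ e
  count-n = trans (cong (count b) n≡) (count-periodic b p periodic k r)
  expand₁ : ∀ k c e p → (k ℕ.* c ℕ.+ e) ℕ.* p ≡ k ℕ.* c ℕ.* p ℕ.+ e ℕ.* p
  expand₁ = ℕSolver.solve-∀
  expand₂ : ∀ k c r p → c ℕ.* (k ℕ.* p ℕ.+ r) ≡ k ℕ.* c ℕ.* p ℕ.+ c ℕ.* r
  expand₂ = ℕSolver.solve-∀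

count-residue-class : ∀ D .{{_ : ℕ.NonZero D}} c k → count (λ i → does ((+ suc i) ≡? c [mod D ])) (k ℕ.* D) ≡ k
count-residue-class D c k = begin
  count b (k ℕ.* D)          ≡⟨ cong (count b) (ℕP.+-identityʳ (k ℕ.* D)) ⟨
  count b (k ℕ.* D ℕ.+ 0)    ≡⟨ count-periodic b D periodic k 0 ⟩
  k ℕ.* count b D ℕ.+ 0      ≡⟨ cong (λ z → k ℕ.* z ℕ.+ 0) one-per-period ⟩
  k ℕ.* 1 ℕ.+ 0              ≡⟨ trans (ℕP.+-identityʳ _) (ℕP.*-identityʳ k) ⟩
  k                          ∎
  where
  open ≡-Reasoning
  b : ℕ → Bool
  b i = does ((+ suc i) ≡? c [mod D ])
  r = (c ℤ.- + 1) ℤDivMod.%ℕ D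
  r<D : r < D
  r<D = ℤDivMod.n%ℕd<d (c ℤ.- + 1) D
  in-class⇔r : ∀ i → i < D → ((+ suc i) ≡ c [mod D ]) ⇔ (i ≡ r)
  in-class⇔r i i<D = mk⇔
    (λ h → residue-unique i<D r<D (≡[mod]-+-cancelˡ (+ 1) (+ i) (+ r)
             (≡[mod]-trans (+ suc i) c (+ suc r) h (≡[mod]-sym (+ suc r) c (≡[mod]-representative D c)))))
    (λ { refl → ≡[mod]-representative D c })
  one-per-period : count b D ≡ 1
  one-per-period = trans
    (count-cong D (λ i i<D → does-⇔ (in-class⇔r i i<D) ((+ suc i) ≡? c [mod D ]) (i ℕ.≟ r)))
    (count-single r<D)
  periodic : ∀ i → b (D ℕ.+ i) ≡ b i
  periodic i = does-⇔
    (subst (λ z → ((+ z) ≡ c [mod D ]) ⇔ ((+ suc i) ≡ c [mod D ])) (cong suc (ℕP.+-comm i D))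
           (≡[mod]-+-period (+ suc i) c ℕD.∣-refl))
    ((+ suc (D ℕ.+ i)) ≡? c [mod D ]) ((+ suc i) ≡? c [mod D ])

∑-residue-class : ∀ M .{{_ : ℕ.NonZero M}} D c → D ℕD.∣ M →
  ∑ (applyUpTo suc M) (λ x → 𝟙 (does ((+ x) ≡? c [mod D ]))) ≡ ι M ℚ.* recip D
∑-residue-class M zero        c (ℕD.divides k refl) = contradiction (ℕP.*-zeroʳ k) (ℕ.≢-nonZero⁻¹ (k ℕ.* 0))
∑-residue-class M D@(suc D′) c (ℕD.divides k refl) = begin
  ∑ xs (λ x → 𝟙 (does (P? x)))                    ≡⟨ length-filter-as-∑ xs P? ⟨
  ι (length (filter P? xs))                       ≡⟨ cong ι (length-filter-applyUpTo P? suc (k ℕ.* D)) ⟩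
  ι (count (λ i → does (P? (suc i))) (k ℕ.* D))   ≡⟨ cong ι (count-residue-class D c k) ⟩
  ι k                                             ≡⟨ ℚP.*-identityʳ (ι k) ⟨
  ι k ℚ.* 1ℚ                                      ≡⟨ cong (ι k ℚ.*_) (ι*recip-cancel D′) ⟨
  ι k ℚ.* (ι D ℚ.* recip D)                       ≡⟨ ℚP.*-assoc (ι k) (ι D) (recip D) ⟨
  ι k ℚ.* ι D ℚ.* recip D                         ≡⟨ cong (ℚ._* recip D) (ι-homo-* k D) ⟨
  ι (k ℕ.* D) ℚ.* recip D                         ∎
  where
  open ≡-Reasoning
  xs = applyUpTo suc (k ℕ.* D)
  P? : ∀ x → Dec ((+ x) ≡ c [mod D ])
  P? x = (+ x) ≡? c [mod D ]

∏-all : {t : ℕ} → (Fin t → ℕ) → ℕ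
∏-all {zero}  d = 1
∏-all {suc t} d = d fzero ℕ.* ∏-all (d ∘ fsuc)

∏-∣-∏-all : ∀ {t} (d : Fin t → ℕ) S → ∏ d S ℕD.∣ ∏-all d
∏-∣-∏-all d []          = ℕD.∣-refl
∏-∣-∏-all d (false ∷ S) = subst (ℕD._∣ ∏-all d) (cong product (map-∘ (members S)))
  (ℕD.∣-trans (∏-∣-∏-all (d ∘ fsuc) S) (ℕD.n∣m*n (d fzero)))
∏-∣-∏-all d (true ∷ S)  = subst (ℕD._∣ ∏-all d) (cong (λ ds → d fzero ℕ.* product ds) (map-∘ (members S)))
  (ℕD.*-monoʳ-∣ (d fzero) (∏-∣-∏-all (d ∘ fsuc) S))

modulus-∣-∏-all : ∀ {t} (d : Fin t → ℕ) j → d j ℕD.∣ ∏-all d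
modulus-∣-∏-all d fzero    = ℕD.m∣m*n _
modulus-∣-∏-all d (fsuc j) = ℕD.∣-trans (modulus-∣-∏-all (d ∘ fsuc) j) (ℕD.n∣m*n (d fzero))

∏-all-nonZero : ∀ {t} (d : Fin t → ℕ) → (∀ i → ℕ.NonZero (d i)) → ℕ.NonZero (∏-all d)
∏-all-nonZero {zero}  d d≢0 = _
∏-all-nonZero {suc t} d d≢0 =
  ℕP.m*n≢0 (d fzero) (∏-all (d ∘ fsuc)) {{d≢0 fzero}} {{∏-all-nonZero (d ∘ fsuc) (d≢0 ∘ fsuc)}}

module _ {t : ℕ} (a : Fin t → ℤ) (d : Fin t → ℕ) where

  satisfiesAll? : ∀ x (S : Subset t) → Dec (SatisfiesAll a d x (members S))
  satisfiesAll? x S = All.all? (λ i → x ≡? a i [mod d i ]) (members S)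

  ∑-satisfiesAll : CoprimeDisjoint a d → ∀ M .{{_ : ℕ.NonZero M}} S → ∏ d S ℕD.∣ M →
    ∑ (applyUpTo suc M) (λ x → 𝟙 (does (satisfiesAll? (+ x) S))) ≡ ι M ℚ.* weight d S
  ∑-satisfiesAll disjoint M S ∏∣M with allPairs? (λ i j → coprime? (d i) (d j)) (members S)
  ... | no ¬coprime = begin
    ∑ xs (λ x → 𝟙 (does (satisfiesAll? (+ x) S)))    ≡⟨ ∑-cong xs unsatisfiable ⟩
    ∑ xs (λ _ → 0ℚ)                                  ≡⟨ ∑-zero xs ⟩
    0ℚ                                               ≡⟨ ℚP.*-zeroʳ (ι M) ⟨
    ι M ℚ.* 0ℚ                                       ≡⟨ cong (ι M ℚ.*_) (ℚP.*-zeroˡ (recip (∏ d S))) ⟨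
    ι M ℚ.* (0ℚ ℚ.* recip (∏ d S))                   ∎
    where
    open ≡-Reasoning
    xs = applyUpTo suc M
    unsatisfiable : ∀ x → 𝟙 (does (satisfiesAll? (+ x) S)) ≡ 0ℚ
    unsatisfiable x = cong 𝟙 (dec-false (satisfiesAll? (+ x) S)
      (¬coprime ∘ satisfiesAll⇒pairwiseCoprime a d disjoint (+ x) (members-distinct S)))
  ... | yes coprime with crt a d (members S) coprime
  ... | c , sat⇔c = begin
    ∑ xs (λ x → 𝟙 (does (satisfiesAll? (+ x) S)))
      ≡⟨ ∑-cong xs (λ x → cong 𝟙 (does-⇔ (sat⇔c (+ x)) (satisfiesAll? (+ x) S) ((+ x) ≡? c [mod ∏ d S ]))) ⟩
    ∑ xs (λ x → 𝟙 (does ((+ x) ≡? c [mod ∏ d S ])))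
      ≡⟨ ∑-residue-class M (∏ d S) c ∏∣M ⟩
    ι M ℚ.* recip (∏ d S)
      ≡⟨ cong (ι M ℚ.*_) (ℚP.*-identityˡ (recip (∏ d S))) ⟨
    ι M ℚ.* (1ℚ ℚ.* recip (∏ d S)) ∎
    where
    open ≡-Reasoning
    xs = applyUpTo suc M

  countA-at-period : CoprimeDisjoint a d → ∀ M .{{_ : ℕ.NonZero M}} → (∀ S → ∏ d S ℕD.∣ M) →
    ι (countA a d M) ≡ ι M ℚ.* rhs d
  countA-at-period disjoint M ∏∣M = begin
    ι (countA a d M)                              ≡⟨ length-filter-as-∑ xs (λ x → inSet? a d (+ x)) ⟩
    ∑ xs (λ x → 𝟙 (does (inSet? a d (+ x))))      ≡⟨ ∑-cong xs complement ⟩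
    ∑ xs (λ x → 1ℚ ℚ.+ ℚ.- 1ℚ ℚ.* B x)            ≡⟨ ∑-distrib-+ xs _ _ ⟩
    ∑ xs (λ _ → 1ℚ) ℚ.+ ∑ xs (λ x → ℚ.- 1ℚ ℚ.* B x)
      ≡⟨ cong₂ ℚ._+_ (trans (∑-const xs) (cong ι (length-applyUpTo suc M))) (∑-*ˡ xs (ℚ.- 1ℚ) B) ⟩
    ι M ℚ.+ ℚ.- 1ℚ ℚ.* ∑ xs B                      ≡⟨ cong (λ z → ι M ℚ.+ ℚ.- 1ℚ ℚ.* z) ∑B ⟩
    ι M ℚ.+ ℚ.- 1ℚ ℚ.* (ι M ℚ.* T)
      ≡⟨ solve 2 (λ m T → m :+ (:- con 1ℚ) :* (m :* T) := m :* (con 1ℚ :- T)) refl (ι M) T ⟩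
    ι M ℚ.* (1ℚ ℚ.- T)                            ≡⟨ cong (ι M ℚ.*_) (rhs-as-signed-∑ d) ⟨
    ι M ℚ.* rhs d                                 ∎
    where
    open ≡-Reasoning
    open +-*-Solver
    xs = applyUpTo suc M
    SS = subsets t
    T = ∑ SS (λ S → signℚ ∣ S ∣ ℚ.* weight d S)
    α : Subset t → ℕ → ℚ
    α S x = 𝟙 (does (satisfiesAll? (+ x) S))
    B : ℕ → ℚ
    B x = ∑ SS (λ S → signℚ ∣ S ∣ ℚ.* α S x)
    complement : ∀ x → 𝟙 (does (inSet? a d (+ x))) ≡ 1ℚ ℚ.+ ℚ.- 1ℚ ℚ.* B x
    complement x = trans (solve 2 (λ A B → A := (A :+ B) :+ (:- con 1ℚ) :* B) refl _ (B x))
      (cong (λ z → z ℚ.+ ℚ.- 1ℚ ℚ.* B x) (inclusion-exclusion t (λ i → (+ x) ≡? a i [mod d i ])))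
    ∑B : ∑ xs B ≡ ι M ℚ.* T
    ∑B = begin
      ∑ xs B                                              ≡⟨ ∑-swap xs SS (λ x S → signℚ ∣ S ∣ ℚ.* α S x) ⟩
      ∑ SS (λ S → ∑ xs (λ x → signℚ ∣ S ∣ ℚ.* α S x))
        ≡⟨ ∑-cong SS (λ S → trans (∑-*ˡ xs (signℚ ∣ S ∣) (α S))
                                  (cong (signℚ ∣ S ∣ ℚ.*_) (∑-satisfiesAll disjoint M S (∏∣M S)))) ⟩
      ∑ SS (λ S → signℚ ∣ S ∣ ℚ.* (ι M ℚ.* weight d S))
        ≡⟨ ∑-cong SS (λ S → solve 3 (λ s m w → s :* (m :* w) := m :* (s :* w)) refl
                                    (signℚ ∣ S ∣) (ι M) (weight d S)) ⟩
      ∑ SS (λ S → ι M ℚ.* (signℚ ∣ S ∣ ℚ.* weight d S))  ≡⟨ ∑-*ˡ SS (ι M) _ ⟩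
      ι M ℚ.* T                                           ∎

  inSet-+-period : ∀ {M} → (∀ j → d j ℕD.∣ M) → ∀ x → InSet a d (x ℤ.+ + M) ⇔ InSet a d x
  inSet-+-period d∣M x = mk⇔
    (λ { (j , h) → j , Equivalence.to (≡[mod]-+-period x (a j) (d∣M j)) h })
    (λ { (j , h) → j , Equivalence.from (≡[mod]-+-period x (a j) (d∣M j)) h })

  countA-as-count : ∀ n → countA a d n ≡ count (λ i → does (inSet? a d (+ suc i))) n
  countA-as-count = length-filter-applyUpTo (λ x → inSet? a d (+ x)) suc

-- |e/n − c/M| = |eM − cn| / (nM) ≤ M/n < 1/↧ε ≤ ε.
cross-deviation⇒close : ∀ e c n M (ε : ℚ) → 0ℚ ℚ.< ε →
  ℤ.∣ e ℕ.* suc M ⊖ c ℕ.* suc n ∣ ≤ suc M ℕ.* suc M → suc M ℕ.* ℚ.↧ₙ ε < suc n →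
  ℚ.∣ + e ℚ./ suc n ℚ.- + c ℚ./ suc M ∣ ℚ.< ε
cross-deviation⇒close e c n M (ℚ.mkℚ +0 _ _)       (ℚ.*<* (ℤ.+<+ ()))
cross-deviation⇒close e c n M (ℚ.mkℚ -[1+ _ ] _ _) (ℚ.*<* ())
cross-deviation⇒close e c n M (ℚ.mkℚ +[1+ p ] q _) _ deviation n-large =
  ℚP.toℚᵘ-cancel-< (ℚᵘP.<-respˡ-≃ (ℚᵘP.≃-sym toℚᵘ-distance) (ℚᵘ.*<* (subst₂ ℤ._<_
    (ℤP.pos-* ℤ.∣ Z ∣ (suc q)) (ℤP.pos-* (suc p) (suc n ℕ.* suc M)) (ℤ.+<+ bound))))
  where
  u = + e ℚ./ suc n
  w = + c ℚ./ suc M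
  U = ℚᵘ.mkℚᵘ (+ e) n ℚᵘ.- ℚᵘ.mkℚᵘ (+ c) M
  toℚᵘ-distance : ℚ.toℚᵘ ℚ.∣ u ℚ.- w ∣ ℚᵘ.≃ ℚᵘ.∣ U ∣
  toℚᵘ-distance = ℚᵘP.≃-trans (ℚP.toℚᵘ-homo-∣-∣ (u ℚ.- w)) (ℚᵘP.∣-∣-cong (ℚᵘP.≃-trans (ℚP.toℚᵘ-homo-+ u (ℚ.- w))
    (ℚᵘP.+-cong (ℚP.toℚᵘ-fromℚᵘ (ℚᵘ.mkℚᵘ (+ e) n))
                (ℚᵘP.≃-trans (ℚP.toℚᵘ-homo‿- w) (ℚᵘP.-‿cong (ℚP.toℚᵘ-fromℚᵘ (ℚᵘ.mkℚᵘ (+ c) M)))))))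
  Z = ℚᵘ.↥ U
  Z≡ : Z ≡ e ℕ.* suc M ⊖ c ℕ.* suc n
  Z≡ = trans (cong₂ ℤ._+_ (sym (ℤP.pos-* e (suc M)))
                          (trans (sym (ℤP.neg-distribˡ-* (+ c) (+ suc n))) (cong ℤ.-_ (sym (ℤP.pos-* c (suc n))))))
             (ℤP.m-n≡m⊖n (e ℕ.* suc M) (c ℕ.* suc n))
  bound : ℤ.∣ Z ∣ ℕ.* suc q < suc p ℕ.* (suc n ℕ.* suc M)
  bound = begin-strict
    ℤ.∣ Z ∣ ℕ.* suc q
      ≤⟨ ℕP.*-monoˡ-≤ (suc q) (subst (_≤ suc M ℕ.* suc M) (cong ℤ.∣_∣ (sym Z≡)) deviation) ⟩
    suc M ℕ.* suc M ℕ.* suc q     ≡⟨ ℕP.*-assoc (suc M) (suc M) (suc q) ⟩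
    suc M ℕ.* (suc M ℕ.* suc q)   <⟨ ℕP.*-monoʳ-< (suc M) n-large ⟩
    suc M ℕ.* suc n               ≡⟨ ℕP.*-comm (suc M) (suc n) ⟩
    suc n ℕ.* suc M               ≤⟨ ℕP.m≤m+n (suc n ℕ.* suc M) _ ⟩
    suc p ℕ.* (suc n ℕ.* suc M)   ∎
    where open ℕP.≤-Reasoning

periodic-density : ∀ b p .{{_ : ℕ.NonZero p}} → (∀ i → b (p ℕ.+ i) ≡ b i) → ∀ ε → 0ℚ ℚ.< ε →
  ∃ λ N₀ → ∀ N → N₀ ≤ N → ℚ.∣ + count b (suc N) ℚ./ suc N ℚ.- + count b p ℚ./ p ∣ ℚ.< ε
periodic-density b p@(suc M) periodic ε 0<ε = p ℕ.* ℚ.↧ₙ ε , λ N N₀≤N →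
  cross-deviation⇒close (count b (suc N)) (count b p) N M ε 0<ε (count-deviation b p periodic (suc N)) (s≤s N₀≤N)

lemma1 : (t : ℕ) (a : Fin t → ℤ) (d : Fin t → ℕ)
    → Injective _≡_ _≡_ d
    → (∀ i → 1 < d i)
    → CoprimeDisjoint a d
    → DensityIs a d (rhs d)
lemma1 _ a d _ 1<d disjoint ε 0<ε = N₀ , λ N N₀≤N →
  subst₂ (λ A s → ℚ.∣ + A ℚ./ suc N ℚ.- s ∣ ℚ.< ε)
         (sym (countA-as-count a d (suc N))) (sym rhs≡average) (close N N₀≤N)
  where
  M = ∏-all d
  instance
    M≢0 : ℕ.NonZero M
    M≢0 = ∏-all-nonZero d (λ i → ℕ.>-nonZero (ℕP.<-trans (s≤s z≤n) (1<d i)))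
  b : ℕ → Bool
  b i = does (inSet? a d (+ suc i))
  periodic : ∀ i → b (M ℕ.+ i) ≡ b i
  periodic i = does-⇔
    (subst (λ z → InSet a d (+ z) ⇔ InSet a d (+ suc i)) (cong suc (ℕP.+-comm i M))
           (inSet-+-period a d (modulus-∣-∏-all d) (+ suc i)))
    (inSet? a d (+ suc (M ℕ.+ i))) (inSet? a d (+ suc i))
  rhs≡average : rhs d ≡ + count b M ℚ./ M
  rhs≡average = ι[x]≡ι[m]*q⇒q≡x/m (count b M) M
    (trans (cong ι (sym (countA-as-count a d M))) (countA-at-period a d disjoint M (∏-∣-∏-all d)))
  N₀ = periodic-density b M periodic ε 0<ε .proj₁
  close = periodic-density b M periodic ε 0<ε .proj₂
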